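{- Let $X$ be a $\mathrm{WL}_6$-closed graph. Then the coherent configuration $\mathrm{WL}(X)$ is $2$-closed.
   Context: Graphs are finite simple undirected, $X=(\Omega,E)$. A coherent configuration on a finite set $\Omega$ is $\mathcal X=(\Omega,S)$ with $S$ a partition of $\Omega^2$ (basis relations) such that $1_\Omega$ is a union of basis relations, $S$ is closed under transposition $s\mapsto s^*$, and for $r,s,t\in S$ the number $|\{\gamma:(\alpha,\gamma)\in r,(\gamma,\beta)\in s\}|$ is constant over $(\alpha,\beta)\in t$. Relations are unions of basis relations. $\mathrm{WL}(r,s,\dots)$ denotes the smallest coherent configuration on $\Omega$ having $r,s,\dots$ as relations; $\mathrm{WL}(X)=\mathrm{WL}(E)$; $\mathrm{WL}(\mathcal X,t)$ is the closure of $S(\mathcal X)\cup\{t\}$. The tensor product $\mathcal X\otimes\mathcal X$ is the coherent configuration on $\Omega^2$ with basis relations $s_1\otimes s_2=\{((\alpha_1,\alpha_2),(\beta_1,\beta_2)):(\alpha_i,\beta_i)\in s_i\}$. For a union $\Delta$ of sets $\Gamma$ with $1_\Gamma$ basis, $\mathcal X_\Delta$ is the coherent configuration on $\Delta$ with basis relations the nonempty $s\cap\Delta^2$. Let $\Delta=\{(\alpha,\alpha):\alpha\in\Omega\}\subseteq\Omega^2$. The $2$-extension of $\mathcal X$ is $\hat{\mathcal X}=\mathrm{WL}(\mathcal X\otimes\mathcal X,1_\Delta)$ (on $\Omega^2$), and the $2$-closure is $\bar{\mathcal X}=(\hat{\mathcal X}_\Delta)^\zeta$, the image of $\hat{\mathcal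 X}_\Delta$ under $\zeta:(\alpha,\alpha)\mapsto\alpha$. One has $\bar{\mathcal X}\ge\mathcal X$; $\mathcal X$ is $2$-closed if $\bar{\mathcal X}=\mathcal X$. $X$ is $\mathrm{WL}_6$-closed if the projections onto the first two coordinates of the classes of the partition $\mathrm{WL}_6(X)$ of $\Omega^6$ produced by the $6$-dimensional Weisfeiler–Leman algorithm are exactly the basis relations of $\mathrm{WL}(X)$. -}

module Defs where

open import Level using (0ℓ)
open import Data.Nat using (ℕ)
open import Data.Fin using (Fin; zero; suc; _≟_)
open import Data.Product using (Σ; ∃; _×_; _,_; proj₁; proj₂)
open import Data.Product.Properties using (≡-dec)
open import Data.List using (List; length; filter; allFin; cartesianProduct)
open import Relation.Binary.PropositionalEquality using (_≡_)
open import Relation.Binary.Definitions using (DecidableEquality)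
open import Relation.Nullary using (¬_; yes; no)
open import Relation.Nullary.Decidable using (_×-dec_)
open import Function.Bundles using (_↔_; Inverse; _⇔_)

record Graph (n : ℕ) : Set₁ where
  field
    E       : Fin n → Fin n → Set
    E-sym   : ∀ {a b} → E a b → E b a
    E-irref : ∀ {a} → ¬ E a a
open Graph public

-- A partition of A × A, given as a colouring of pairs (classes = basis
-- relations = nonempty fibres of col).

record Coloring (A : Set) : Set₁ where
  field
    Col  : Set
    _≟c_ : DecidableEquality Col
    col  : A → A → Col
open Coloring public

Same : {A : Set} → Coloring A → A → A → A → A → Set
Same X a b c d = col X a b ≡ col X c d

-- R ⊆ A² is a relation of X (a union of basis relations)
IsRelation : {A : Set} → Coloring A → (A → A → Set) → Set
IsRelation X R = ∀ a b c d → Same X a b c d → R a b → R c d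

-- X ≤ Y : Y is finer than X (every basis relation of X is a relation of Y)
_≼_ : {A : Set} → Coloring A → Coloring A → Set
X ≼ Y = ∀ a b c d → Same Y a b c d → Same X a b c d

-- number of γ in the enumeration with (α,γ) ∈ r and (γ,β) ∈ s, where
-- r is the basis relation containing (r₁,r₂), s the one containing (s₁,s₂)
interNum : {A : Set} → List A → (X : Coloring A) → A → A → A → A → A → A → ℕ
interNum enum X r₁ r₂ s₁ s₂ α β =
  length (filter (λ γ → (_≟c_ X (col X α γ) (col X r₁ r₂))
                        ×-dec (_≟c_ X (col X γ β) (col X s₁ s₂))) enum)

-- coherent configuration on A, where enum lists every element of A exactly once
record IsCC {A : Set} (enum : List A) (X : Coloring A) : Set where
  field
    diag   : ∀ a c d → Same X a a c d → c ≡ d          -- 1_A is a relation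
    transp : ∀ a b c d → Same X a b c d → Same X b a d c
    inter  : ∀ r₁ r₂ s₁ s₂ α β α' β' → Same X α β α' β' →
             interNum enum X r₁ r₂ s₁ s₂ α β ≡ interNum enum X r₁ r₂ s₁ s₂ α' β'

Ω² : ℕ → Set
Ω² n = Fin n × Fin n

enumΩ : ∀ n → List (Fin n)
enumΩ n = allFin n

enumΩ² : ∀ n → List (Ω² n)
enumΩ² n = cartesianProduct (allFin n) (allFin n)

record IsWL {n : ℕ} (G : Graph n) (X : Coloring (Fin n)) : Set₁ where
  field
    cc      : IsCC (enumΩ n) X
    hasE    : IsRelation X (E G)
    minimal : ∀ (Y : Coloring (Fin n)) → IsCC (enumΩ n) Y → IsRelation Y (E G) → X ≼ Y

_⊗C_ : {n : ℕ} → Coloring (Fin n) → Coloring (Fin n) → Coloring (Ω² n)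
X ⊗C Y = record
  { Col  = Col X × Col Y
  ; _≟c_ = ≡-dec (_≟c_ X) (_≟c_ Y)
  ; col  = λ p q → (col X (proj₁ p) (proj₁ q) , col Y (proj₂ p) (proj₂ q))
  }

oneΔ : {n : ℕ} → Ω² n → Ω² n → Set
oneΔ p q = (p ≡ q) × (proj₁ p ≡ proj₂ p)

record IsTwoExtension {n : ℕ} (X : Coloring (Fin n)) (Xh : Coloring (Ω² n)) : Set₁ where
  field
    cc      : IsCC (enumΩ² n) Xh
    hasXX   : (X ⊗C X) ≼ Xh
    hasΔ    : IsRelation Xh oneΔ
    minimal : ∀ (Y : Coloring (Ω² n)) → IsCC (enumΩ² n) Y →
              (X ⊗C X) ≼ Y → IsRelation Y oneΔ → Xh ≼ Y

closure : {n : ℕ} → Coloring (Ω² n) → Coloring (Fin n)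
closure Xh = record
  { Col = Col Xh ; _≟c_ = _≟c_ Xh ; col = λ a b → col Xh (a , a) (b , b) }

TwoClosed : {n : ℕ} → Coloring (Fin n) → Coloring (Ω² n) → Set
TwoClosed X Xh = ∀ a b c d → Same X a b c d ⇔ Same (closure Xh) a b c d

Tuple : ℕ → ℕ → Set
Tuple k n = Fin k → Fin n

upd : {k n : ℕ} → Tuple k n → Fin k → Fin n → Tuple k n
upd x i z j with j ≟ i
... | yes _ = z
... | no  _ = x j

AtomicEq : {k n : ℕ} → Graph n → Tuple k n → Tuple k n → Set
AtomicEq G x y = ∀ i j → ((x i ≡ x j) ⇔ (y i ≡ y j)) × (E G (x i) (x j) ⇔ E G (y i) (y j))

-- colour classes after t refinement rounds: x ~_{t+1} y iff x ~_t y and the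
-- multisets {{ (c_t(x[1←z]),…,c_t(x[k←z])) : z ∈ Ω }} and the same for y
-- coincide (i.e. some bijection π of Ω matches them)
WLround : {k n : ℕ} → Graph n → ℕ → Tuple k n → Tuple k n → Set
WLround G ℕ.zero x y = AtomicEq G x y
WLround {k} {n} G (ℕ.suc t) x y =
  WLround G t x y ×
  Σ (Fin n ↔ Fin n) (λ π → ∀ z (i : Fin k) →
      WLround G t (upd x i z) (upd y i (Inverse.to π z)))

WL-k : (k : ℕ) {n : ℕ} → Graph n → Tuple k n → Tuple k n → Set
WL-k k G x y = ∀ t → WLround G t x y

projClass : {n : ℕ} → Graph n → Tuple 6 n → Fin n → Fin n → Set
projClass {n} G x a b = Σ (Tuple 6 n) λ y → (y zero ≡ a) × (y (suc zero) ≡ b) × WL-k 6 G y x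

basisRel : {n : ℕ} → Coloring (Fin n) → Fin n → Fin n → Fin n → Fin n → Set
basisRel X a b c d = Same X a b c d

WL6Closed : {n : ℕ} → Graph n → Set₁
WL6Closed {n} G = ∀ (X : Coloring (Fin n)) → IsWL G X →
  (∀ (x : Tuple 6 n) → Σ (Fin n) λ a → Σ (Fin n) λ b →
      ∀ c d → projClass G x c d ⇔ basisRel X a b c d)
  × (∀ (a b : Fin n) → Σ (Tuple 6 n) λ x →
      ∀ c d → projClass G x c d ⇔ basisRel X a b c d)

{-# OPTIONS --safe #-}
-- Colour a pair (p, q) of points of Ω² by the WL₆-class of the 6-tuple (p₁, p₂, q₁, q₂, q₁, q₂).
-- This colouring Y is a coherent configuration on Ω²: the last two coordinates are spare pebbles
-- that can be moved onto a third point γ and copied so as to read off the colours of (α, γ) and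
-- (γ, β), and the two pebble moves are matched by a fibred bijection (z, w) ↦ (σ z, τ_z w) of Ω²,
-- which preserves intersection numbers. By WL₆-closedness, WL₆ refines WL(X) on the first two
-- coordinates, so Y refines X ⊗ X; and 1_Δ is a relation of Y. Hence the 2-extension is coarser
-- than Y. Again by WL₆-closedness, two pairs in one basis relation of X are the first two
-- coordinates of WL₆-equivalent tuples, which copying turns into equivalent tuples
-- (a, a, b, b, b, b) and (c, c, d, d, d, d): the diagonal pairs have the same colour in Y, hence
-- in the 2-extension.
--
-- Constructively, WL₆ is not known to be decidable nor to be fixed by a further refinement round.
-- Both hold at the level where the decreasing chain of WL rounds stabilises, whose existence is
-- shown under double negation; that suffices since equality of colours in the 2-extension is
-- decidable.
module Submission where

open import Level using (0ℓ)
open import Data.Bool using (Bool; true; false; if_then_else_)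
import Data.Bool.Properties as Bool
open import Data.Fin using (Fin; toℕ; fromℕ<; _≟_)
open import Data.Fin.Patterns using (0F; 1F; 2F; 3F; 4F; 5F)
import Data.Fin.Properties as FinProperties
open import Data.List using (List; []; _∷_; _++_; length; filter; map; tabulate; allFin; cartesianProduct; cartesianProductWith)
open import Data.List.Membership.Propositional using (_∈_)
open import Data.List.Membership.Propositional.Properties
  using (∈-filter⁺; ∈-filter⁻; ∈-allFin; ∈-cartesianProductWith⁺; ∈-cartesianProduct⁺)
open import Data.List.Properties using (length-filter; filter-++; length-++; map-cong; ∷-injectiveˡ; ∷-injectiveʳ; ≡-dec)
open import Data.List.Relation.Binary.Equality.Propositional using (≋⇒≡)
open import Data.List.Relation.Binary.Sublist.Propositional using (⊆-refl) renaming (_⊆_ to _⊑_)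
open import Data.List.Relation.Binary.Sublist.Propositional.Properties using (filter⁺; length-mono-≤; to-≋)
import Data.List.Relation.Unary.All as All
open import Data.List.Relation.Unary.Any using (here; there)
open import Data.Nat using (ℕ; zero; suc; _+_; _≤_; z≤n; s≤s; _≤′_; ≤′-refl; ≤′-step; _≤?_)
open import Data.Nat.Properties
  using (≤-trans; ≤-total; ≤⇒≤′; n≤1+n; m≤n⇒m≤1+n; n≤0⇒n≡0; ≤∧≢⇒<; <-≤-trans; ≤-pred; +-0-commutativeMonoid)
  renaming (_≟_ to _≟ℕ_)
open import Algebra.Properties.CommutativeMonoid.Sum +-0-commutativeMonoid using (sum; sum-cong-≗; sum-permute)
open import Data.Product using (Σ; ∃-syntax; _×_; _,_; proj₁; proj₂; uncurry)
open import Data.Product.Function.NonDependent.Propositional using (_×-⇔_)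
open import Data.Sum using (inj₁; inj₂)
import Data.Vec.Functional as Vector
open import Effect.Monad using (RawMonad)
open import Function.Base using (_∘_; id)
open import Function.Bundles using (_⇔_; _↔_; Equivalence; Inverse; mk⇔)
open import Function.Construct.Composition using (_⇔-∘_; _↔-∘_)
open import Function.Construct.Identity using (⇔-id; ↔-id)
open import Function.Construct.Symmetry using (⇔-sym; ↔-sym)
open import Relation.Binary.PropositionalEquality
  using (_≡_; _≢_; _≗_; refl; sym; trans; subst; cong; cong₂; module ≡-Reasoning)
open import Relation.Binary.Structures using (IsDecEquivalence)
import Relation.Binary.Definitions as Binary
open import Relation.Nullary using (¬_; Dec; does; yes; no; contradiction)
open import Relation.Nullary.Decidable as Dec
  using (¬¬-excluded-middle; decidable-stable; does-⇔; dec-true; False; toWitnessFalse)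
open import Relation.Nullary.Negation using (¬¬-Monad; ¬¬-map)
open import Relation.Unary using (Pred; Decidable; _⊆_)
open import Defs

open RawMonad (¬¬-Monad {0ℓ}) using (pure; _>>=_; rawApplicative)

¬¬-bounded : {F : ℕ → Set} → (∀ t → ¬ ¬ F t) → ∀ M → ¬ ¬ (∀ t → t ≤ M → F t)
¬¬-bounded {F} ¬¬F M = do
  F≤M ← FinProperties.sequence rawApplicative (¬¬F ∘ toℕ {suc M})
  pure λ t t≤M → subst F (FinProperties.toℕ-fromℕ< (s≤s t≤M)) (F≤M (fromℕ< (s≤s t≤M)))

-- Counting

module _ {A : Set} {P Q : Pred A 0ℓ} (P? : Decidable P) (Q? : Decidable Q) (P⊆Q : P ⊆ Q) (xs : List A) where

  filter-⊑ : filter P? xs ⊑ filter Q? xs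
  filter-⊑ = filter⁺ P? Q? {as = xs} {bs = xs} (λ { refl → P⊆Q }) ⊆-refl

  length-filter-mono : length (filter P? xs) ≤ length (filter Q? xs)
  length-filter-mono = length-mono-≤ {as = filter P? xs} {bs = filter Q? xs} filter-⊑

  length-filter-≡⇒⊇ : length (filter P? xs) ≡ length (filter Q? xs) → ∀ {x} → x ∈ xs → Q x → P x
  length-filter-≡⇒⊇ eq x∈xs Qx =
    proj₂ (∈-filter⁻ P? {xs = xs} (subst (_ ∈_) filter-Q≡filter-P (∈-filter⁺ Q? x∈xs Qx)))
    where
    filter-Q≡filter-P : filter Q? xs ≡ filter P? xs
    filter-Q≡filter-P = sym (≋⇒≡ (to-≋ {as = filter P? xs} {bs = filter Q? xs} eq filter-⊑))

iverson : Bool → ℕ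
iverson b = if b then 1 else 0

module _ {A : Set} {P : Pred A 0ℓ} (P? : Decidable P) where

  length-filter-map : ∀ {B : Set} (g : B → A) (ys : List B) →
                      length (filter P? (map g ys)) ≡ length (filter (P? ∘ g) ys)
  length-filter-map g [] = refl
  length-filter-map g (y ∷ ys) with does (P? (g y))
  ... | true = cong suc (length-filter-map g ys)
  ... | false = length-filter-map g ys

  length-filter-tabulate : ∀ {m} (f : Fin m → A) →
                           length (filter P? (tabulate f)) ≡ sum (λ i → iverson (does (P? (f i))))
  length-filter-tabulate {zero} f = refl
  length-filter-tabulate {suc m} f with does (P? (f 0F))
  ... | true = cong suc (length-filter-tabulate (f ∘ Fin.suc))
  ... | false = length-filter-tabulate (f ∘ Fin.suc)

module _ {A B : Set} {P : Pred (A × B) 0ℓ} (P? : Decidable P) where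

  length-filter-cartesianProduct : ∀ {m} (f : Fin m → A) (ys : List B) →
    length (filter P? (cartesianProduct (tabulate f) ys)) ≡ sum (λ i → length (filter (P? ∘ (f i ,_)) ys))
  length-filter-cartesianProduct {zero} f ys = refl
  length-filter-cartesianProduct {suc m} f ys = begin
    length (filter P? (map (f 0F ,_) ys ++ rest))
      ≡⟨ cong length (filter-++ P? (map (f 0F ,_) ys) rest) ⟩
    length (filter P? (map (f 0F ,_) ys) ++ filter P? rest)
      ≡⟨ length-++ (filter P? (map (f 0F ,_) ys)) ⟩
    length (filter P? (map (f 0F ,_) ys)) + length (filter P? rest)
      ≡⟨ cong₂ _+_ (length-filter-map P? (f 0F ,_) ys) (length-filter-cartesianProduct (f ∘ Fin.suc) ys) ⟩
    sum (λ i → length (filter (P? ∘ (f i ,_)) ys)) ∎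
    where
    open ≡-Reasoning
    rest : List (A × B)
    rest = cartesianProduct (tabulate (f ∘ Fin.suc)) ys

module _ {m : ℕ} {P Q : Pred (Fin m) 0ℓ} (P? : Decidable P) (Q? : Decidable Q) where

  length-filter-allFin-↔ : (σ : Fin m ↔ Fin m) → (∀ i → P i ⇔ Q (Inverse.to σ i)) →
                           length (filter P? (allFin m)) ≡ length (filter Q? (allFin m))
  length-filter-allFin-↔ σ P⇔Q∘σ = begin
    length (filter P? (allFin m))                     ≡⟨ length-filter-tabulate P? id ⟩
    sum (λ i → iverson (does (P? i)))                 ≡⟨ sum-cong-≗ (λ i → cong iverson (does-⇔ (P⇔Q∘σ i) (P? i) (Q? _))) ⟩
    sum (λ i → iverson (does (Q? (Inverse.to σ i))))  ≡⟨ sum-permute (λ i → iverson (does (Q? i))) σ ⟨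
    sum (λ i → iverson (does (Q? i)))                 ≡⟨ length-filter-tabulate Q? id ⟨
    length (filter Q? (allFin m))                     ∎
    where open ≡-Reasoning

module _ {m : ℕ} {P Q : Pred (Fin m × Fin m) 0ℓ} (P? : Decidable P) (Q? : Decidable Q) where

  length-filter-allFin²-fibred-↔ : (σ : Fin m ↔ Fin m) (τ : Fin m → Fin m ↔ Fin m) →
    (∀ z w → P (z , w) ⇔ Q (Inverse.to σ z , Inverse.to (τ z) w)) →
    length (filter P? (cartesianProduct (allFin m) (allFin m))) ≡
    length (filter Q? (cartesianProduct (allFin m) (allFin m)))
  length-filter-allFin²-fibred-↔ σ τ P⇔Q∘στ = begin
    length (filter P? (cartesianProduct (allFin m) (allFin m)))
      ≡⟨ length-filter-cartesianProduct P? id (allFin m) ⟩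
    sum (λ z → length (filter (P? ∘ (z ,_)) (allFin m)))
      ≡⟨ sum-cong-≗ (λ z → length-filter-allFin-↔ (P? ∘ (z ,_)) (Q? ∘ (Inverse.to σ z ,_)) (τ z) (P⇔Q∘στ z)) ⟩
    sum (λ z → length (filter (Q? ∘ (Inverse.to σ z ,_)) (allFin m)))
      ≡⟨ sum-permute (λ z → length (filter (Q? ∘ (z ,_)) (allFin m))) σ ⟨
    sum (λ z → length (filter (Q? ∘ (z ,_)) (allFin m)))
      ≡⟨ length-filter-cartesianProduct Q? id (allFin m) ⟨
    length (filter Q? (cartesianProduct (allFin m) (allFin m))) ∎
    where open ≡-Reasoning

-- Stabilisation of decreasing chains

decreasing-stalls : ∀ b (f : ℕ → ℕ) → (∀ t → f (suc t) ≤ f t) → f 0 ≤ b →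
                    ∃[ t ] t ≤ b × f (suc t) ≡ f t
decreasing-stalls zero f decreasing f0≤0 =
  0 , z≤n , trans (n≤0⇒n≡0 (≤-trans (decreasing 0) f0≤0)) (sym (n≤0⇒n≡0 f0≤0))
decreasing-stalls (suc b) f decreasing f0≤1+b with f 1 ≟ℕ f 0
... | yes stall = 0 , z≤n , stall
... | no f1≢f0 =
  let t , t≤b , stall = decreasing-stalls b (f ∘ suc) (decreasing ∘ suc)
                          (≤-pred (<-≤-trans (≤∧≢⇒< (decreasing 0) f1≢f0) f0≤1+b))
  in suc t , s≤s t≤b , stall

module Stabilisation {B : Set} (P : ℕ → Pred B 0ℓ)
  (P-anti : ∀ t {b} → P (suc t) b → P t b)
  (xs : List B) (represent : ∀ b → ∃[ b' ] b' ∈ xs × (∀ t → P t b' ⇔ P t b))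
  where

  Stable : ℕ → Set
  Stable t = ∀ {b} → P t b → P (suc t) b

  antitone : ∀ {t u b} → t ≤′ u → P u b → P t b
  antitone ≤′-refl p = p
  antitone (≤′-step t≤′u) p = antitone t≤′u (P-anti _ p)

  ¬¬-decidable : ∀ t → ¬ ¬ Decidable (P t)
  ¬¬-decidable t = do
    decisions ← All.sequenceM 0ℓ ¬¬-Monad (All.universal (λ _ → ¬¬-excluded-middle) xs)
    pure λ b → let b' , b'∈xs , P[b']⇔P[b] = represent b
               in Dec.map (P[b']⇔P[b] t) (All.lookup {P = Dec ∘ P t} decisions b'∈xs)

  M : ℕ
  M = suc (length xs)

  -- The counts of the chain are only decided up to M; cutting the chain off after M keeps it
  -- decreasing, and the stall found below |xs| < M lies inside the window.
  module _ (P? : ∀ t → t ≤ M → Decidable (P t)) where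

    Window : ℕ → Pred B 0ℓ
    Window t b = t ≤ M × P t b

    window? : ∀ t → Decidable (Window t)
    window? t b with t ≤? M
    ... | yes t≤M = Dec.map′ (t≤M ,_) proj₂ (P? t t≤M b)
    ... | no t≰M = no (t≰M ∘ proj₁)

    window-anti : ∀ t → Window (suc t) ⊆ Window t
    window-anti t (1+t≤M , p) = ≤-trans (n≤1+n t) 1+t≤M , P-anti t p

    count : ℕ → ℕ
    count t = length (filter (window? t) xs)

    count-anti : ∀ t → count (suc t) ≤ count t
    count-anti t = length-filter-mono (window? (suc t)) (window? t) (window-anti t) xs

    stall⇒stable : ∀ {T} → T ≤ length xs → count (suc T) ≡ count T → Stable T
    stall⇒stable {T} T≤|xs| stall {b} p =
      let b' , b'∈xs , P[b']⇔P[b] = represent b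
          window-b' = length-filter-≡⇒⊇ (window? (suc T)) (window? T) (window-anti T) xs stall b'∈xs
                        (m≤n⇒m≤1+n T≤|xs| , Equivalence.from (P[b']⇔P[b] T) p)
      in Equivalence.to (P[b']⇔P[b] (suc T)) (proj₂ window-b')

    stable-time : ∃[ T ] T ≤ M × Stable T
    stable-time =
      let T , T≤|xs| , stall = decreasing-stalls (length xs) count count-anti (length-filter (window? 0) xs)
      in T , m≤n⇒m≤1+n T≤|xs| , stall⇒stable T≤|xs| stall

  module _ (propagate : ∀ {t} → Stable t → Stable (suc t)) where

    stable-after : ∀ {t u} → t ≤′ u → Stable t → Stable u
    stable-after ≤′-refl st = st
    stable-after (≤′-step t≤′u) st = propagate (stable-after t≤′u st)

    persists : ∀ {t u b} → t ≤′ u → Stable t → P t b → P u b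
    persists ≤′-refl st p = p
    persists (≤′-step t≤′u) st p = stable-after t≤′u st (persists t≤′u st p)

    stable-forever : ∀ {T b} → Stable T → P T b → ∀ u → P u b
    stable-forever {T} st p u with ≤-total u T
    ... | inj₁ u≤T = antitone (≤⇒≤′ u≤T) p
    ... | inj₂ T≤u = persists (≤⇒≤′ T≤u) st p

    ¬¬-stabilises : ¬ ¬ (∃[ T ] Decidable (P T) × (∀ {b} → P T b → ∀ u → P u b))
    ¬¬-stabilises = do
      P? ← ¬¬-bounded ¬¬-decidable M
      let T , T≤M , st = stable-time P?
      pure (T , P? T T≤M , λ {b} → stable-forever st)

map-≡⇒≡-∈ : ∀ {A B : Set} {f g : A → B} {xs} → map f xs ≡ map g xs → ∀ {x} → x ∈ xs → f x ≡ g x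
map-≡⇒≡-∈ {xs = _ ∷ _} eq (here refl) = ∷-injectiveˡ eq
map-≡⇒≡-∈ {xs = _ ∷ _} eq (there x∈xs) = map-≡⇒≡-∈ (∷-injectiveʳ eq) x∈xs

does≡true⇒ : ∀ {A : Set} (a? : Dec A) → does a? ≡ true → A
does≡true⇒ (yes a) _ = a

module ClassColouring {A : Set} {_~_ : A → A → Set} (~-isDecEquivalence : IsDecEquivalence _~_)
  (xs : List A) (covers : ∀ a → ∃[ a' ] a' ∈ xs × a' ~ a) where

  open IsDecEquivalence ~-isDecEquivalence using () renaming (_≟_ to _~?_; sym to ~-sym; trans to ~-trans)

  classOf : A → List Bool
  classOf a = map (λ v → does (a ~? v)) xs

  classOf-≡⇔ : ∀ {a b} → classOf a ≡ classOf b ⇔ a ~ b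
  classOf-≡⇔ {a} {b} = mk⇔ ≡⇒~ ~⇒≡
    where
    ~⇒≡ : a ~ b → classOf a ≡ classOf b
    ~⇒≡ a~b = map-cong (λ v → does-⇔ (mk⇔ (~-trans (~-sym a~b)) (~-trans a~b)) (a ~? v) (b ~? v)) xs

    ≡⇒~ : classOf a ≡ classOf b → a ~ b
    ≡⇒~ eq =
      let v , v∈xs , v~b = covers b
      in ~-trans (does≡true⇒ (a ~? v) (trans (map-≡⇒≡-∈ eq v∈xs) (dec-true (b ~? v) (~-sym v~b)))) v~b

-- The Weisfeiler–Leman refinement

module _ {k n : ℕ} where

  upd-at : ∀ (x : Tuple k n) i z → upd x i z i ≡ z
  upd-at x i z with i ≟ i
  ... | yes _ = refl
  ... | no i≢i = contradiction refl i≢i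

  upd-elsewhere : ∀ (x : Tuple k n) i z {j} → j ≢ i → upd x i z j ≡ x j
  upd-elsewhere x i z {j} j≢i with j ≟ i
  ... | yes j≡i = contradiction j≡i j≢i
  ... | no _ = refl

  upd-≗ : ∀ {x y : Tuple k n} → x ≗ y → ∀ i z → upd x i z ≗ upd y i z
  upd-≗ x≗y i z j with j ≟ i
  ... | yes _ = refl
  ... | no _ = x≗y j

allTuples : ∀ {n} k → List (Tuple k n)
allTuples zero = Vector.[] ∷ []
allTuples {n} (suc k) = cartesianProductWith Vector._∷_ (allFin n) (allTuples k)

allTuples-complete : ∀ {n k} (x : Tuple k n) → ∃[ x' ] x' ∈ allTuples k × x' ≗ x
allTuples-complete {k = zero} x = Vector.[] , here refl , λ ()
allTuples-complete {k = suc k} x =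
  let x' , x'∈ , x'≗ = allTuples-complete (Vector.tail x)
  in x 0F Vector.∷ x' , ∈-cartesianProductWith⁺ Vector._∷_ (∈-allFin _) x'∈
   , λ { Fin.zero → refl ; (Fin.suc i) → x'≗ i }

module WLRefinement {n : ℕ} (G : Graph n) where

  module _ {k : ℕ} where

    ≗⇒AtomicEq : {x y : Tuple k n} → x ≗ y → AtomicEq G x y
    ≗⇒AtomicEq {x} {y} x≗y i j rewrite x≗y i | x≗y j = ⇔-id _ , ⇔-id _

    AtomicEq-sym : {x y : Tuple k n} → AtomicEq G x y → AtomicEq G y x
    AtomicEq-sym x~y i j = let =⇔ , E⇔ = x~y i j in ⇔-sym =⇔ , ⇔-sym E⇔

    AtomicEq-trans : {x y w : Tuple k n} → AtomicEq G x y → AtomicEq G y w → AtomicEq G x w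
    AtomicEq-trans x~y y~w i j =
      let =⇔ , E⇔ = x~y i j ; =⇔' , E⇔' = y~w i j in =⇔' ⇔-∘ =⇔ , E⇔' ⇔-∘ E⇔

    _≈[_]_ : Tuple k n → ℕ → Tuple k n → Set
    x ≈[ t ] y = WLround G t x y

    _≈_ : Tuple k n → Tuple k n → Set
    _≈_ = WL-k k G

    ≗⇒≈[] : ∀ t {x y} → x ≗ y → x ≈[ t ] y
    ≗⇒≈[] zero x≗y = ≗⇒AtomicEq x≗y
    ≗⇒≈[] (suc t) x≗y = ≗⇒≈[] t x≗y , ↔-id _ , λ z i → ≗⇒≈[] t (upd-≗ x≗y i z)

    ≈[]-sym : ∀ t {x y} → x ≈[ t ] y → y ≈[ t ] x
    ≈[]-sym zero = AtomicEq-sym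
    ≈[]-sym (suc t) {x} {y} (x≈y , π , step) = ≈[]-sym t x≈y , ↔-sym π , λ z i →
      subst (λ v → upd y i v ≈[ t ] upd x i (Inverse.from π z)) (Inverse.strictlyInverseˡ π z)
            (≈[]-sym t (step (Inverse.from π z) i))

    ≈[]-trans : ∀ t {x y w} → x ≈[ t ] y → y ≈[ t ] w → x ≈[ t ] w
    ≈[]-trans zero = AtomicEq-trans
    ≈[]-trans (suc t) (x≈y , π , step) (y≈w , π' , step') =
      ≈[]-trans t x≈y y≈w , π' ↔-∘ π , λ z i → ≈[]-trans t (step z i) (step' (Inverse.to π z) i)

    ≈[]-resp-≗ : ∀ t {x x' y y'} → x ≗ x' → y ≗ y' → x ≈[ t ] y → x' ≈[ t ] y'
    ≈[]-resp-≗ t x≗x' y≗y' x≈y = ≈[]-trans t (≗⇒≈[] t (sym ∘ x≗x')) (≈[]-trans t x≈y (≗⇒≈[] t y≗y'))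

    ≈[]⇒AtomicEq : ∀ t {x y} → x ≈[ t ] y → AtomicEq G x y
    ≈[]⇒AtomicEq zero x≈y = x≈y
    ≈[]⇒AtomicEq (suc t) (x≈y , _) = ≈[]⇒AtomicEq t x≈y

    ≈[]-copy : ∀ t {x y} {i j} → i ≢ j → x ≈[ suc t ] y → upd x j (x i) ≈[ t ] upd y j (y i)
    ≈[]-copy t {x} {y} {i} {j} i≢j (_ , π , step) =
      subst (λ v → upd x j (x i) ≈[ t ] upd y j v) π[xi]≡yi (step (x i) j)
      where
      -- upd x j (x i) has equal entries at i and j, hence so has upd y j (π (x i)).
      π[xi]≡yi : Inverse.to π (x i) ≡ y i
      π[xi]≡yi = trans (sym (upd-at y j _))
        (trans (Equivalence.to (proj₁ (≈[]⇒AtomicEq t (step (x i) j) j i))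
                  (trans (upd-at x j (x i)) (sym (upd-elsewhere x j (x i) i≢j))))
               (upd-elsewhere y j _ i≢j))

    ≈[]-propagate : ∀ {t} → (∀ {x y} → x ≈[ t ] y → x ≈[ suc t ] y) →
                    ∀ {x y} → x ≈[ suc t ] y → x ≈[ suc (suc t) ] y
    ≈[]-propagate stable (x≈y , π , step) = (x≈y , π , step) , π , λ z i → stable (step z i)

    ≈-refl : ∀ {x} → x ≈ x
    ≈-refl t = ≗⇒≈[] t (λ _ → refl)

    ≈-sym : ∀ {x y} → x ≈ y → y ≈ x
    ≈-sym x≈y t = ≈[]-sym t (x≈y t)

    ≈-trans : ∀ {x y w} → x ≈ y → y ≈ w → x ≈ w
    ≈-trans x≈y y≈w t = ≈[]-trans t (x≈y t) (y≈w t)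

    ≈-resp-≗ : ∀ {x x' y y'} → x ≗ x' → y ≗ y' → x ≈ y → x' ≈ y'
    ≈-resp-≗ x≗x' y≗y' x≈y t = ≈[]-resp-≗ t x≗x' y≗y' (x≈y t)

    ≈-transfers-≡ : ∀ {x y} → x ≈ y → ∀ i j → x i ≡ x j → y i ≡ y j
    ≈-transfers-≡ x≈y i j = Equivalence.to (proj₁ (x≈y 0 i j))

    ≈-copy : ∀ i j {i≢j : False (i ≟ j)} {x y} → x ≈ y → upd x j (x i) ≈ upd y j (y i)
    ≈-copy i j {i≢j} x≈y t = ≈[]-copy t (toWitnessFalse i≢j) (x≈y (suc t))

    record Stabilised : Set where
      field
        _≈?_   : Binary.Decidable _≈_
        ≈-step : ∀ {x y} → x ≈ y → Σ (Fin n ↔ Fin n) λ π → ∀ z i → upd x i z ≈ upd y i (Inverse.to π z)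

    ¬¬-stabilised : ¬ ¬ Stabilised
    ¬¬-stabilised = do
      T , ≈[T]? , persists ← ¬¬-stabilises propagate
      pure record
        { _≈?_   = λ x y → Dec.map (mk⇔ persists (λ x≈y → x≈y T)) (≈[T]? (x , y))
        ; ≈-step = λ x≈y → let _ , π , step = x≈y (suc T) in π , λ z i → persists (step z i)
        }
      where
      represent : ∀ ((x , y) : Tuple k n × Tuple k n) → ∃[ (x' , y') ] (x' , y') ∈ cartesianProduct (allTuples k) (allTuples k)
                                                          × (∀ t → x' ≈[ t ] y' ⇔ x ≈[ t ] y)
      represent (x , y) =
        let x' , x'∈ , x'≗x = allTuples-complete x ; y' , y'∈ , y'≗y = allTuples-complete y
        in (x' , y') , ∈-cartesianProduct⁺ x'∈ y'∈
         , λ t → mk⇔ (≈[]-resp-≗ t x'≗x y'≗y) (≈[]-resp-≗ t (sym ∘ x'≗x) (sym ∘ y'≗y))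

      open Stabilisation (λ t → uncurry _≈[ t ]_) (λ t → proj₁) (cartesianProduct (allTuples k) (allTuples k)) represent

      propagate : ∀ {t} → Stable t → Stable (suc t)
      propagate stable {x , y} = ≈[]-propagate (λ {x} {y} → stable {x , y})

-- The pebble colouring of Ω²

≗-Fin6 : ∀ {A : Set} {f g : Fin 6 → A} →
         f 0F ≡ g 0F → f 1F ≡ g 1F → f 2F ≡ g 2F → f 3F ≡ g 3F → f 4F ≡ g 4F → f 5F ≡ g 5F → f ≗ g
≗-Fin6 e₀ e₁ e₂ e₃ e₄ e₅ 0F = e₀
≗-Fin6 e₀ e₁ e₂ e₃ e₄ e₅ 1F = e₁
≗-Fin6 e₀ e₁ e₂ e₃ e₄ e₅ 2F = e₂
≗-Fin6 e₀ e₁ e₂ e₃ e₄ e₅ 3F = e₃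
≗-Fin6 e₀ e₁ e₂ e₃ e₄ e₅ 4F = e₄
≗-Fin6 e₀ e₁ e₂ e₃ e₄ e₅ 5F = e₅

pebbles : ∀ {n} → Ω² n → Ω² n → Tuple 6 n
pebbles (a₁ , a₂) (b₁ , b₂) = a₁ Vector.∷ a₂ Vector.∷ b₁ Vector.∷ b₂ Vector.∷ b₁ Vector.∷ b₂ Vector.∷ Vector.[]

module PebbleColouring {n : ℕ} (G : Graph n) (S : WLRefinement.Stabilised G {6}) where

  open WLRefinement G
  open Stabilised S

  ≈-isDecEquivalence : IsDecEquivalence (_≈_ {6})
  ≈-isDecEquivalence = record
    { isEquivalence = record { refl = ≈-refl ; sym = ≈-sym ; trans = ≈-trans }
    ; _≟_ = _≈?_
    }

  allTuples-covers : ∀ x → ∃[ x' ] x' ∈ allTuples 6 × x' ≈ x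
  allTuples-covers x = let x' , x'∈ , x'≗x = allTuples-complete x in x' , x'∈ , ≈-resp-≗ (λ _ → refl) x'≗x ≈-refl

  open ClassColouring ≈-isDecEquivalence (allTuples 6) allTuples-covers

  Y : Coloring (Ω² n)
  Y = record { Col = List Bool ; _≟c_ = ≡-dec Bool._≟_ ; col = λ p q → classOf (pebbles p q) }

  Same-Y⇔ : ∀ {p q p' q'} → Same Y p q p' q' ⇔ pebbles p q ≈ pebbles p' q'
  Same-Y⇔ = classOf-≡⇔

  pebbles-≡ : ∀ {p q p' q'} → pebbles p q ≈ pebbles p' q' → p ≡ q → p' ≡ q'
  pebbles-≡ e p≡q = cong₂ _,_ (≈-transfers-≡ e 0F 2F (cong proj₁ p≡q)) (≈-transfers-≡ e 1F 3F (cong proj₂ p≡q))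

  pebbles-transpose : ∀ {p q p' q'} → pebbles p q ≈ pebbles p' q' → pebbles q p ≈ pebbles q' p'
  pebbles-transpose e = ≈-resp-≗ (≗-Fin6 refl refl refl refl refl refl) (≗-Fin6 refl refl refl refl refl refl)
    ((≈-copy 5F 3F ∘ ≈-copy 4F 2F ∘ ≈-copy 3F 1F ∘ ≈-copy 2F 0F ∘ ≈-copy 1F 5F ∘ ≈-copy 0F 4F) e)

  pebbles-split : ∀ {α β α' β'} → pebbles α β ≈ pebbles α' β' →
    Σ (Fin n ↔ Fin n) λ σ → Σ (Fin n → Fin n ↔ Fin n) λ τ → ∀ z w →
      let γ' = (Inverse.to σ z , Inverse.to (τ z) w)
      in pebbles α (z , w) ≈ pebbles α' γ' × pebbles (z , w) β ≈ pebbles γ' β'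
  pebbles-split {α} {β} {α'} {β'} e =
    σ , τ , λ z w → let moved = proj₂ (≈-step (step z 4F)) w 5F in
      ≈-resp-≗ (≗-Fin6 refl refl refl refl refl refl) (≗-Fin6 refl refl refl refl refl refl)
        ((≈-copy 5F 3F ∘ ≈-copy 4F 2F) moved) ,
      ≈-resp-≗ (≗-Fin6 refl refl refl refl refl refl) (≗-Fin6 refl refl refl refl refl refl)
        ((≈-copy 3F 5F ∘ ≈-copy 2F 4F ∘ ≈-copy 5F 1F ∘ ≈-copy 4F 0F) moved)
    where
    σ : Fin n ↔ Fin n
    σ = proj₁ (≈-step e)
    step : ∀ z i → upd (pebbles α β) i z ≈ upd (pebbles α' β') i (Inverse.to σ z)
    step = proj₂ (≈-step e)
    τ : Fin n → Fin n ↔ Fin n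
    τ z = proj₁ (≈-step (step z 4F))

  Y-isCC : IsCC (enumΩ² n) Y
  Y-isCC = record
    { diag   = λ _ _ _ same → pebbles-≡ (Equivalence.to Same-Y⇔ same) refl
    ; transp = λ _ _ _ _ same → Equivalence.from Same-Y⇔ (pebbles-transpose (Equivalence.to Same-Y⇔ same))
    ; inter  = λ _ _ _ _ _ _ _ _ same →
        let σ , τ , moves = pebbles-split (Equivalence.to Same-Y⇔ same)
        in length-filter-allFin²-fibred-↔ _ _ σ τ λ z w →
             let αγ , γβ = moves z w
             in retarget (Equivalence.from Same-Y⇔ αγ) ×-⇔ retarget (Equivalence.from Same-Y⇔ γβ)
    }
    where
    retarget : ∀ {A : Set} {a a' c : A} → a ≡ a' → (a ≡ c) ⇔ (a' ≡ c)
    retarget a≡a' = mk⇔ (trans (sym a≡a')) (trans a≡a')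

  Y-hasΔ : IsRelation Y oneΔ
  Y-hasΔ _ _ _ _ same (p≡q , p₁≡p₂) =
    let e = Equivalence.to Same-Y⇔ same in pebbles-≡ e p≡q , ≈-transfers-≡ e 0F 1F p₁≡p₂

module TwoClosure {n : ℕ} (G : Graph n) (closed : WL6Closed G) (X : Coloring (Fin n)) (X-WL : IsWL G X) where

  open WLRefinement G

  ≈-refines-X : ∀ {u v : Tuple 6 n} → u ≈ v → Same X (u 0F) (u 1F) (v 0F) (v 1F)
  ≈-refines-X {u} {v} u≈v =
    let _ , _ , proj⇔basis = proj₁ (closed X X-WL) u
    in trans (sym (Equivalence.to (proj⇔basis (u 0F) (u 1F)) (u , refl , refl , ≈-refl)))
             (Equivalence.to (proj⇔basis (v 0F) (v 1F)) (v , refl , refl , ≈-sym u≈v))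

  Same-X⇒≈ : ∀ {a b c d} → Same X a b c d → pebbles (a , a) (b , b) ≈ pebbles (c , c) (d , d)
  Same-X⇒≈ {a} {b} {c} {d} same =
    let _ , proj⇔basis = proj₂ (closed X X-WL) a b
        u , u₀ , u₁ , u≈x = Equivalence.from (proj⇔basis a b) refl
        v , v₀ , v₁ , v≈x = Equivalence.from (proj⇔basis c d) same
    in ≈-resp-≗ (≗-Fin6 u₀ u₀ u₁ u₁ u₁ u₁) (≗-Fin6 v₀ v₀ v₁ v₁ v₁ v₁)
         ((≈-copy 0F 1F ∘ ≈-copy 1F 5F ∘ ≈-copy 1F 4F ∘ ≈-copy 1F 3F ∘ ≈-copy 1F 2F) (≈-trans u≈x (≈-sym v≈x)))

  module _ (S : Stabilised {6}) where

    open PebbleColouring G S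

    X⊗X≼Y : (X ⊗C X) ≼ Y
    X⊗X≼Y _ _ _ _ same =
      let e = Equivalence.to Same-Y⇔ same
      in cong₂ _,_ (≈-refines-X (≈-copy 2F 1F e)) (≈-refines-X ((≈-copy 3F 1F ∘ ≈-copy 1F 0F) e))

    Same-X⇒Same-closure : ∀ {Xh a b c d} → IsTwoExtension X Xh → Same X a b c d → Same (closure Xh) a b c d
    Same-X⇒Same-closure Xh-ext same =
      IsTwoExtension.minimal Xh-ext Y Y-isCC X⊗X≼Y Y-hasΔ _ _ _ _ (Equivalence.from Same-Y⇔ (Same-X⇒≈ same))

lemma2p1 : (n : ℕ) (G : Graph n) → WL6Closed G →
           (X : Coloring (Fin n)) → IsWL G X →
           (Xh : Coloring (Ω² n)) → IsTwoExtension X Xh →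
           TwoClosed X Xh
lemma2p1 n G closed X X-WL Xh Xh-ext a b c d = mk⇔ X⊆closure closure⊆X
  where
  open TwoClosure G closed X X-WL

  X⊆closure : Same X a b c d → Same (closure Xh) a b c d
  X⊆closure same = decidable-stable (_≟c_ Xh _ _)
    (¬¬-map (λ S → Same-X⇒Same-closure S Xh-ext same) (WLRefinement.¬¬-stabilised G))

  closure⊆X : Same (closure Xh) a b c d → Same X a b c d
  closure⊆X same = cong proj₁ (IsTwoExtension.hasXX Xh-ext _ _ _ _ same)
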